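{- For every integer $s\ge 2$, the entry in row $1$, column $s$ of the multivariable circuit array is $$C^M_{1,s}=\frac{(9^{s-1}-1)+X_1}{3\left(X_1+3\cdot 9^{s-2}-1\right)}.$$
   Context: An $n$-grid is a graph isomorphic to the graph whose vertices are the integer points $(2r+s,s)$ with $0\le r\le n$, $0\le s\le n-r$, two vertices $(x,y),(x',y')$ being adjacent iff $(x'-x,y'-y)\in\{(1,1),(2,0),(1,-1)\}$. Its upright unit triangles are indexed $T_{r,d}$ ($r=1,\dots,n$ the row from the apex downward, $d=1,\dots,r$ the position from the left), each with left, right and base edges $L,R,B$; $T_{r,d,e}$ denotes the label (resistance) of edge $e$. Every edge lies in exactly one upright triangle. Row reduction turns a labelled $n$-grid into a labelled $(n-1)$-grid: (1) Δ–Y transform every upright triangle, the spoke at the vertex shared by triangle edges $x,y$ getting label $\Delta(x,y,z)=xy/(x+y+z)$ ($z$ the third edge); (2) delete the spokes at the three corners; (3) merge consecutive spokes at each remaining degree-two boundary vertex into one edge labelled by their sum; (4) Y–Δ transform each remaining star with spokes $a,b,c$, the edge opposite spoke $a$ getting label $Y(a,b,c)=(ab+bc+ca)/a$. The result is an $(n-1)$-grid on the centres of the parent's upright triangles. $T^m_{r,d,e}$ denotes labels after $m$ reductions. Numerical circuit array: for the all-one $n$-grid ($n$ large, e.g. $n\ge 4j-2$), $C_{i,j}=T^j_{2j-1,\,j-\lfloor(i+1)/2\rfloor,\,e}$ for $j\ge1$, $0\le i\le 2(j-1)$, with $e=L$ for $i$ even, $e=R$ for $i$ odd. The multivariable circuit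 array $C^M$ is computed in the same way, one reduction at a time, but with the entries of the left-side diagonal replaced by indeterminates: after the first reduction the boundary label $2/3=C_{0,1}=T^1_{1,1,L}$ is replaced by an indeterminate $X_1$, and for each $i\ge 2$ the left-side diagonal value $C_{2(i-1),i}=T^i_{2i-1,1,L}$ is replaced by an indeterminate $X_i$; all other entries are then computed symbolically by the reduction formulas, so that $C^M_{i,j}$ is a rational function of $X_1,X_2,\dots$. -}

module Defs where

open import Data.Nat as ℕ using (ℕ; zero; suc; _∸_; _≡ᵇ_)
open import Data.Integer using (+_)
open import Data.Rational using (ℚ; 0ℚ; 1ℚ; _+_; _*_; _÷_; _/_; ≢-nonZero)
open import Data.Rational.Properties using (_≟_)
open import Data.Bool using (Bool; true; false; if_then_else_; _∧_)
open import Relation.Nullary using (yes; no)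

-- Total division on ℚ (value 0 when dividing by 0).  In all uses below
-- with positive labels, denominators are sums of positive numbers, so
-- the junk value is never reached.

infixl 7 _⊘_
_⊘_ : ℚ → ℚ → ℚ
p ⊘ q with q ≟ 0ℚ
... | yes _   = 0ℚ
... | no q≢0  = _÷_ p q {{≢-nonZero q≢0}}

ℕ→ℚ : ℕ → ℚ
ℕ→ℚ n = + n / 1

-- Labelled grids.
-- Edges of an upright unit triangle.
data Edge : Set where
  L R B : Edge

-- A labelling of an n-grid: T r d e is the label T_{r,d,e}
-- (1 ≤ r ≤ n, 1 ≤ d ≤ r; values at other indices are irrelevant).
Labelling : Set
Labelling = ℕ → ℕ → Edge → ℚ

Δ : ℚ → ℚ → ℚ → ℚ
Δ x y z = (x * y) ⊘ (x + y + z)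

Yf : ℚ → ℚ → ℚ → ℚ
Yf a b c = (a * b + b * c + c * a) ⊘ a

-- Spokes after the Δ–Y transform of the upright triangle T_{r,d}:
-- at its apex (edges L,R), bottom-left vertex (L,B), bottom-right vertex (R,B).
spokeApex spokeBL spokeBR : Labelling → ℕ → ℕ → ℚ
spokeApex T r d = Δ (T r d L) (T r d R) (T r d B)
spokeBL   T r d = Δ (T r d L) (T r d B) (T r d R)
spokeBR   T r d = Δ (T r d R) (T r d B) (T r d L)

-- Row reduction of a labelled n-grid (n = first argument) to an
-- (n-1)-grid.  The centre of T_{r,d} becomes vertex (r-1,d-1) of the
-- new grid.  New edges arise either from merging the two spokes at a
-- boundary vertex (steps 2,3) or from the Y–Δ transform of the star at
-- an interior vertex (step 4):
--  * L of T'_{r,1}   : left boundary vertex (r,0)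
--  * L of T'_{r,d},d>1: interior vertex (r,d-1), opposite its spoke to T_{r,d-1}
--  * R of T'_{r,r}   : right boundary vertex (r,r)
--  * R of T'_{r,d},d<r: interior vertex (r,d), opposite its spoke to T_{r,d+1}
--  * B of T'_{n-1,d} : bottom boundary vertex (n,d)
--  * B of T'_{r,d},r<n-1: interior vertex (r+1,d), opposite its spoke to T_{r+2,d+1}
reduce : ℕ → Labelling → Labelling
reduce n T r d L =
  if d ≡ᵇ 1
  then spokeBL T r 1 + spokeApex T (suc r) 1
  else Yf (spokeBR T r (d ∸ 1)) (spokeApex T (suc r) d) (spokeBL T r d)
reduce n T r d R =
  if d ≡ᵇ r
  then spokeBR T r r + spokeApex T (suc r) (suc r)
  else Yf (spokeBL T r (suc d)) (spokeApex T (suc r) (suc d)) (spokeBR T r d)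
reduce n T r d B =
  if suc r ≡ᵇ n
  then spokeBR T n d + spokeBL T n (suc d)
  else Yf (spokeApex T (suc (suc r)) (suc d)) (spokeBR T (suc r) d) (spokeBL T (suc r) (suc d))

allOne : Labelling
allOne _ _ _ = 1ℚ

setLeftBoundary : ℚ → Labelling → Labelling
setLeftBoundary x T r d L = if d ≡ᵇ 1 then x else T r d L
setLeftBoundary x T r d e = T r d e

setLeftEntry : ℕ → ℚ → Labelling → Labelling
setLeftEntry r0 x T r d L = if (r ≡ᵇ r0) ∧ (d ≡ᵇ 1) then x else T r d L
setLeftEntry r0 x T r d e = T r d e

-- Multivariable reduction sequence starting from the all-one n-grid,
-- with indeterminate values X : ℕ → ℚ (X i stands for X_i, X 0 unused).
-- gridM X n m is the labelling T^m of the (n-m)-grid.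
--  * after reduction 1, the boundary label 2/3 (on every left-boundary
--    edge T^1_{r,1,L}) is replaced by X_1;
--  * after reduction i ≥ 2, T^i_{2i-1,1,L} is replaced by X_i.
gridM : (ℕ → ℚ) → ℕ → ℕ → Labelling
gridM X n zero = allOne
gridM X n (suc zero) = setLeftBoundary (X 1) (reduce n allOne)
gridM X n (suc (suc m)) =
  setLeftEntry (suc (2 ℕ.* suc m)) (X (suc (suc m)))
    (reduce (n ∸ suc m) (gridM X n (suc m)))

-- Multivariable circuit array computed on the n-grid:
-- C^M_{i,j} = T^j_{2j-1, j - ⌊(i+1)/2⌋, e}, e = L for i even, R for i odd.
CM : (ℕ → ℚ) → ℕ → ℕ → ℕ → ℚ
CM X n i j =
  gridM X n j (2 ℕ.* j ∸ 1) (j ∸ ((suc i) ℕ./ 2))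
    (if (i ℕ.% 2) ≡ᵇ 0 then L else R)

{-# OPTIONS --safe #-}
-- After the first reduction the all-one grid carries X₁ on its left boundary
-- and 1 on every interior edge.  Far enough from the right and bottom
-- boundaries, each further reduction keeps every label equal to 1 except the
-- left edges of a single column, which moves one step to the right while its
-- label evolves by b ↦ Y(Δ(1,1,b), 1/3, 1/3) = (b + 8)/9; the indeterminates
-- X_i (i ≥ 2) are substituted in column 1 and never reach this strip.  Hence
-- b_k = 1 + (X₁ - 1)/9^k, and C^M_{1,s} is the right edge of the loaded column
-- after one more reduction, Y(1/3, 1/3, Δ(1,1,b_{s-2})) = 1/3 + 2/(2 + b_{s-2}),
-- which simplifies to the stated fraction.

module Submission where

open import Defs
open import Data.Nat as ℕ using (ℕ; _≤_; _∸_; _^_)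
open import Data.Rational using (ℚ; _<_; 0ℚ; 1ℚ; _+_; _-_; _*_)
open import Relation.Binary.PropositionalEquality using (_≡_)

open import Level using (0ℓ)
open import Data.Bool using (true; false; if_then_else_)
open import Data.Bool.Properties using (∧-zeroʳ)
open import Data.Integer using (+_)
import Data.Integer.Properties as ℤ
open import Data.List using (_∷_; [])
open import Data.Nat using (zero; suc; s≤s; z≤n; _≡ᵇ_)
import Data.Nat.Coprimality as Coprime
import Data.Nat.Properties as ℕ
open import Data.Nat.Tactic.RingSolver using (solve-∀)
open import Data.Product using (_×_; _,_; proj₁; proj₂)
open import Data.Rational using (_/_; 1/_; mkℚ; ≢-nonZero)
import Data.Rational.Properties as ℚ
open import Relation.Binary.PropositionalEquality
  using (_≢_; _≗_; refl; sym; trans; cong; cong₂; subst; module ≡-Reasoning)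
open import Relation.Nullary using (yes; no; contradiction)
open import Relation.Nullary.Decidable using (dec-true; dec-false; dec⇒maybe)
open import Tactic.RingSolver using (solve)
open import Tactic.RingSolver.Core.AlmostCommutativeRing
  using (AlmostCommutativeRing; fromCommutativeRing)

ℚ-ring : AlmostCommutativeRing 0ℓ 0ℓ
ℚ-ring = fromCommutativeRing ℚ.+-*-commutativeRing (λ p → dec⇒maybe (0ℚ ℚ.≟ p))

p⊘q*q≡p : ∀ p {q} → q ≢ 0ℚ → p ⊘ q * q ≡ p
p⊘q*q≡p p {q} q≢0 with q ℚ.≟ 0ℚ
... | yes q≡0 = contradiction q≡0 q≢0
... | no q≢0′ = begin
  p * 1/ q * q    ≡⟨ ℚ.*-assoc p (1/ q) q ⟩
  p * (1/ q * q)  ≡⟨ cong (p *_) (ℚ.*-inverseˡ q) ⟩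
  p * 1ℚ          ≡⟨ ℚ.*-identityʳ p ⟩
  p               ∎
  where
  open ≡-Reasoning
  instance _ = ≢-nonZero q≢0′

⊘-unique : ∀ {p q} c → q ≢ 0ℚ → p ≡ c * q → p ⊘ q ≡ c
⊘-unique {p} {q} c q≢0 p≡cq with q ℚ.≟ 0ℚ
... | yes q≡0 = contradiction q≡0 q≢0
... | no q≢0′ = begin
  p * 1/ q        ≡⟨ cong (_* 1/ q) p≡cq ⟩
  c * q * 1/ q    ≡⟨ ℚ.*-assoc c q (1/ q) ⟩
  c * (q * 1/ q)  ≡⟨ cong (c *_) (ℚ.*-inverseʳ q) ⟩
  c * 1ℚ          ≡⟨ ℚ.*-identityʳ c ⟩
  c               ∎
  where
  open ≡-Reasoning
  instance _ = ≢-nonZero q≢0′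

>⇒≢0 : ∀ {p} → 0ℚ < p → p ≢ 0ℚ
>⇒≢0 0<p p≡0 = ℚ.<⇒≢ 0<p (sym p≡0)

*≡≢0⇒≢0ˡ : ∀ {p q r} → p * q ≡ r → r ≢ 0ℚ → p ≢ 0ℚ
*≡≢0⇒≢0ˡ {q = q} pq≡r r≢0 refl = r≢0 (trans (sym pq≡r) (ℚ.*-zeroˡ q))

ℕ→ℚ-homo-* : ∀ m n → ℕ→ℚ (m ℕ.* n) ≡ ℕ→ℚ m * ℕ→ℚ n
ℕ→ℚ-homo-* m n =
  trans (cong (_/ 1) (ℤ.pos-* m n)) (cong₂ _*_ (sym (as-mkℚ m)) (sym (as-mkℚ n)))
  where
  as-mkℚ : ∀ a → ℕ→ℚ a ≡ mkℚ (+ a) 0 (Coprime.sym (Coprime.1-coprimeTo a))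
  as-mkℚ a = ℚ.normalize-coprime (Coprime.sym (Coprime.1-coprimeTo a))

ℕ→ℚ-≢0 : ∀ n .{{_ : ℕ.NonZero n}} → ℕ→ℚ n ≢ 0ℚ
ℕ→ℚ-≢0 n = >⇒≢0 (ℚ.positive⁻¹ (ℕ→ℚ n) {{ℚ.normalize-pos n 1}})

≢⇒≡ᵇ≡false : ∀ {m n} → m ≢ n → (m ≡ᵇ n) ≡ false
≢⇒≡ᵇ≡false {m} {n} = dec-false (m ℕ.≟ n)

≡ᵇ-refl : ∀ n → (n ≡ᵇ n) ≡ true
≡ᵇ-refl n = dec-true (n ℕ.≟ n) refl

cong₃ : ∀ (f : ℚ → ℚ → ℚ → ℚ) {a a′ b b′ c c′} →
        a ≡ a′ → b ≡ b′ → c ≡ c′ → f a b c ≡ f a′ b′ c′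
cong₃ f refl refl refl = refl

module _ (n : ℕ) (T S : Labelling) {r d : ℕ} where

  reduce-L-local : d ≢ 1 →
    T r (d ∸ 1) ≗ S r (d ∸ 1) → T (suc r) d ≗ S (suc r) d → T r d ≗ S r d →
    reduce n T r d L ≡ reduce n S r d L
  reduce-L-local d≢1 left below here rewrite ≢⇒≡ᵇ≡false d≢1 =
    cong₃ Yf (cong₃ Δ (left R) (left B) (left L))
             (cong₃ Δ (below L) (below R) (below B))
             (cong₃ Δ (here L) (here B) (here R))

  reduce-R-local : d ≢ r →
    T r (suc d) ≗ S r (suc d) → T (suc r) (suc d) ≗ S (suc r) (suc d) → T r d ≗ S r d →
    reduce n T r d R ≡ reduce n S r d R
  reduce-R-local d≢r right below here rewrite ≢⇒≡ᵇ≡false d≢r =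
    cong₃ Yf (cong₃ Δ (right L) (right B) (right R))
             (cong₃ Δ (below L) (below R) (below B))
             (cong₃ Δ (here R) (here B) (here L))

  reduce-B-local : suc r ≢ n →
    T (suc (suc r)) (suc d) ≗ S (suc (suc r)) (suc d) →
    T (suc r) d ≗ S (suc r) d → T (suc r) (suc d) ≗ S (suc r) (suc d) →
    reduce n T r d B ≡ reduce n S r d B
  reduce-B-local r+1≢n below left right rewrite ≢⇒≡ᵇ≡false r+1≢n =
    cong₃ Yf (cong₃ Δ (below L) (below R) (below B))
             (cong₃ Δ (left R) (left B) (left L))
             (cong₃ Δ (right L) (right B) (right R))

third : ℚ
third = + 1 / 3

stripLabel : (ℕ → ℚ) → ℕ → ℚ
stripLabel X zero    = X 1
stripLabel X (suc k) = Yf (Δ 1ℚ 1ℚ (stripLabel X k)) third third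

-- The grid after k + 1 reductions, away from its boundaries.
strip : (ℕ → ℚ) → ℕ → Labelling
strip X k r d L = if d ≡ᵇ suc k then stripLabel X k else 1ℚ
strip X k r d R = 1ℚ
strip X k r d B = 1ℚ

-- Where the strip picture holds: from the loaded column rightwards, and far
-- enough from the right and bottom boundaries to survive further reductions,
-- whose stars reach one column to the right and two rows down.
InStrip : ℕ → ℕ → ℕ → ℕ → Set
InStrip n k r d = suc k ≤ d × d ℕ.+ suc k ≤ r × r ℕ.+ 2 ℕ.* suc k ≤ n

-- The spokes of an all-one triangle are Δ 1ℚ 1ℚ 1ℚ, which evaluates to third,
-- so both sides compute to the same value once the comparisons are decided.
reduce-strip : ∀ X k {m r d} → k ≤ d → suc (suc d) ℕ.< r → suc r ℕ.< m →
  reduce m (strip X k) r (suc (suc d)) ≗ strip X (suc k) r (suc (suc d))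
reduce-strip X k {d = d} k≤d _ _ L rewrite ≢⇒≡ᵇ≡false (ℕ.>⇒≢ (s≤s k≤d)) with d ≡ᵇ k
... | true  = refl
... | false = refl
reduce-strip X k k≤d c<r _ R
  rewrite ≢⇒≡ᵇ≡false (ℕ.<⇒≢ c<r) | ≢⇒≡ᵇ≡false (ℕ.>⇒≢ (s≤s k≤d))
        | ≢⇒≡ᵇ≡false (ℕ.>⇒≢ (s≤s (ℕ.m≤n⇒m≤1+n k≤d))) = refl
reduce-strip X k k≤d _ r+1<m B
  rewrite ≢⇒≡ᵇ≡false (ℕ.<⇒≢ r+1<m) | ≢⇒≡ᵇ≡false (ℕ.>⇒≢ (s≤s k≤d))
        | ≢⇒≡ᵇ≡false (ℕ.>⇒≢ (s≤s (ℕ.m≤n⇒m≤1+n k≤d))) = refl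

reduce-strip-R-next-to-loaded : ∀ X k {m r} → suc k ℕ.< r →
  reduce m (strip X k) r (suc k) R ≡ Yf third third (Δ 1ℚ 1ℚ (stripLabel X k))
reduce-strip-R-next-to-loaded X k k+1<r
  rewrite ≢⇒≡ᵇ≡false (ℕ.<⇒≢ k+1<r) | ≢⇒≡ᵇ≡false (ℕ.1+n≢n {k}) | ≡ᵇ-refl k = refl

two-rows-down : ∀ r k → 2 ℕ.+ r ℕ.+ 2 ℕ.* suc k ≡ r ℕ.+ 2 ℕ.* suc (suc k)
two-rows-down = solve-∀

InStrip-shift : ∀ {n k r d} i j → i ≤ 2 → j ≤ 2 →
  InStrip n (suc k) r (suc d) → InStrip n k (i ℕ.+ r) (j ℕ.+ d)
InStrip-shift {n} {k} {r} {d} i j i≤2 j≤2 (s≤s k<d , d+k+2≤r , r+2k+4≤n) =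
  ℕ.≤-trans k<d (ℕ.m≤n+m d j) , column , row
  where
  open ℕ.≤-Reasoning
  column : j ℕ.+ d ℕ.+ suc k ≤ i ℕ.+ r
  column = begin
    j ℕ.+ d ℕ.+ suc k      ≤⟨ ℕ.+-monoˡ-≤ (suc k) (ℕ.+-monoˡ-≤ d j≤2) ⟩
    2 ℕ.+ d ℕ.+ suc k      ≡⟨ cong suc (sym (ℕ.+-suc d (suc k))) ⟩
    suc d ℕ.+ suc (suc k)  ≤⟨ d+k+2≤r ⟩
    r                      ≤⟨ ℕ.m≤n+m r i ⟩
    i ℕ.+ r                ∎
  row : i ℕ.+ r ℕ.+ 2 ℕ.* suc k ≤ n
  row = begin
    i ℕ.+ r ℕ.+ 2 ℕ.* suc k  ≤⟨ ℕ.+-monoˡ-≤ (2 ℕ.* suc k) (ℕ.+-monoˡ-≤ r i≤2) ⟩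
    2 ℕ.+ r ℕ.+ 2 ℕ.* suc k  ≡⟨ two-rows-down r k ⟩
    r ℕ.+ 2 ℕ.* suc (suc k)  ≤⟨ r+2k+4≤n ⟩
    n                        ∎

setLeftEntry-beyond : ∀ {r₀ x T r} d → setLeftEntry r₀ x T r (suc (suc d)) ≗ T r (suc (suc d))
setLeftEntry-beyond {r₀} {r = r} d L rewrite ∧-zeroʳ (r ≡ᵇ r₀) = refl
setLeftEntry-beyond d R = refl
setLeftEntry-beyond d B = refl

gridM-strip : ∀ X n k {r d} → InStrip n k r d → gridM X n (suc k) r d ≗ strip X k r d
gridM-strip X n zero {d = suc zero} _ L = refl
gridM-strip X n zero {d = suc (suc d)} _ L = refl
gridM-strip X n zero {r} {d} (_ , d+1≤r , _) R
  rewrite ≢⇒≡ᵇ≡false (ℕ.<⇒≢ (ℕ.<-≤-trans (ℕ.m<m+n d (s≤s z≤n)) d+1≤r)) = refl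
gridM-strip X n zero {r} (_ , _ , r+2≤n) B
  rewrite ≢⇒≡ᵇ≡false (ℕ.<⇒≢ (subst (_≤ n) (ℕ.+-comm r 2) r+2≤n)) = refl
gridM-strip X n (suc k) {r} {suc (suc d)} region@(s≤s (s≤s k≤d) , _ , _) e = begin
  gridM X n (suc (suc k)) r (suc (suc d)) e ≡⟨ setLeftEntry-beyond d e ⟩
  reduce m G r (suc (suc d)) e              ≡⟨ local e ⟩
  reduce m (strip X k) r (suc (suc d)) e    ≡⟨ reduce-strip X k k≤d c<r r+1<m e ⟩
  strip X (suc k) r (suc (suc d)) e         ∎
  where
  open ≡-Reasoning
  m : ℕ
  m = n ∸ suc k
  G : Labelling
  G = gridM X n (suc k)
  neighbour : ∀ i j → i ≤ 2 → j ≤ 2 → G (i ℕ.+ r) (j ℕ.+ suc d) ≗ strip X k (i ℕ.+ r) (j ℕ.+ suc d)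
  neighbour i j i≤2 j≤2 = gridM-strip X n k (InStrip-shift i j i≤2 j≤2 region)
  c<r : suc (suc d) ℕ.< r
  c<r = ℕ.<-≤-trans (ℕ.m<m+n (suc (suc d)) (s≤s z≤n))
          (proj₁ (proj₂ (InStrip-shift 0 1 z≤n (s≤s z≤n) region)))
  r+1<m : suc r ℕ.< m
  r+1<m = ℕ.m+n≤o⇒m≤o∸n (suc (suc r))
            (ℕ.≤-trans (ℕ.+-monoʳ-≤ (suc (suc r)) (ℕ.m≤m+n (suc k) (suc k ℕ.+ 0)))
                       (proj₂ (proj₂ (InStrip-shift 2 0 ℕ.≤-refl z≤n region))))
  local : ∀ e → reduce m G r (suc (suc d)) e ≡ reduce m (strip X k) r (suc (suc d)) e
  local L = reduce-L-local m G (strip X k) (λ ())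
              (neighbour 0 0 z≤n z≤n) (neighbour 1 1 (s≤s z≤n) (s≤s z≤n))
              (neighbour 0 1 z≤n (s≤s z≤n))
  local R = reduce-R-local m G (strip X k) (ℕ.<⇒≢ c<r)
              (neighbour 0 2 z≤n ℕ.≤-refl) (neighbour 1 2 (s≤s z≤n) ℕ.≤-refl)
              (neighbour 0 1 z≤n (s≤s z≤n))
  local B = reduce-B-local m G (strip X k) (ℕ.<⇒≢ r+1<m)
              (neighbour 2 2 ℕ.≤-refl ℕ.≤-refl) (neighbour 1 1 (s≤s z≤n) (s≤s z≤n))
              (neighbour 1 2 (s≤s z≤n) ℕ.≤-refl)

gridM-R-next-to-strip : ∀ X n k {r} → suc (suc k) ℕ.+ suc k ≤ r → suc r ℕ.+ 2 ℕ.* suc k ≤ n →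
  gridM X n (suc (suc k)) r (suc k) R ≡ Yf third third (Δ 1ℚ 1ℚ (stripLabel X k))
gridM-R-next-to-strip X n k {r} column row = begin
  reduce m G r (suc k) R
    ≡⟨ reduce-R-local m G (strip X k) (ℕ.<⇒≢ k+1<r)
         (gridM-strip X n k (ℕ.n≤1+n (suc k) , column , ℕ.<⇒≤ row))
         (gridM-strip X n k (ℕ.n≤1+n (suc k) , ℕ.m≤n⇒m≤1+n column , row))
         (gridM-strip X n k (ℕ.≤-refl , ℕ.<⇒≤ column , ℕ.<⇒≤ row)) ⟩
  reduce m (strip X k) r (suc k) R
    ≡⟨ reduce-strip-R-next-to-loaded X k {m} k+1<r ⟩
  Yf third third (Δ 1ℚ 1ℚ (stripLabel X k)) ∎
  where
  open ≡-Reasoning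
  m : ℕ
  m = n ∸ suc k
  G : Labelling
  G = gridM X n (suc k)
  k+1<r : suc k ℕ.< r
  k+1<r = ℕ.≤-trans (ℕ.m≤m+n (suc (suc k)) (suc k)) column

CM-1-strip : ∀ X n k → 4 ℕ.* suc (suc k) ∸ 2 ≤ n →
  CM X n 1 (suc (suc k)) ≡ Yf third third (Δ 1ℚ 1ℚ (stripLabel X k))
CM-1-strip X n k 4s-2≤n = gridM-R-next-to-strip X n k (ℕ.≤-reflexive (sym r≡)) row
  where
  two-s : ∀ k → 2 ℕ.* suc (suc k) ≡ 1 ℕ.+ (suc (suc k) ℕ.+ suc k)
  two-s = solve-∀
  four-s : ∀ k → 4 ℕ.* suc (suc k) ≡ 2 ℕ.+ (suc (suc (suc k) ℕ.+ suc k) ℕ.+ 2 ℕ.* suc k)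
  four-s = solve-∀
  r≡ : 2 ℕ.* suc (suc k) ∸ 1 ≡ suc (suc k) ℕ.+ suc k
  r≡ = cong (_∸ 1) (two-s k)
  row : suc (2 ℕ.* suc (suc k) ∸ 1) ℕ.+ 2 ℕ.* suc k ≤ n
  row = subst (_≤ n) (trans (cong (_∸ 2) (four-s k)) (cong (λ r → suc r ℕ.+ 2 ℕ.* suc k) (sym r≡))) 4s-2≤n

Δ-one-one : ∀ b → 0ℚ < b → Δ 1ℚ 1ℚ b * (1ℚ + 1ℚ + b) ≡ 1ℚ
Δ-one-one b 0<b = p⊘q*q≡p 1ℚ (>⇒≢0 (ℚ.+-mono-< (ℚ.positive⁻¹ (1ℚ + 1ℚ)) 0<b))

Yf-third-third : ∀ t b → t * (1ℚ + 1ℚ + b) ≡ 1ℚ → Yf t third third ≡ (b + ℕ→ℚ 8) * (+ 1 / 9)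
Yf-third-third t b t[2+b]≡1 = ⊘-unique _ (*≡≢0⇒≢0ˡ t[2+b]≡1 λ ()) (begin
  t * third + third * third + third * t
    ≡⟨ solve (t ∷ b ∷ []) ℚ-ring ⟩
  (b + ℕ→ℚ 8) * (+ 1 / 9) * t + + 1 / 9 * (1ℚ - t * (1ℚ + 1ℚ + b))
    ≡⟨ cong (λ u → (b + ℕ→ℚ 8) * (+ 1 / 9) * t + + 1 / 9 * (1ℚ - u)) t[2+b]≡1 ⟩
  (b + ℕ→ℚ 8) * (+ 1 / 9) * t + + 1 / 9 * (1ℚ - 1ℚ)
    ≡⟨ solve (t ∷ b ∷ []) ℚ-ring ⟩
  (b + ℕ→ℚ 8) * (+ 1 / 9) * t ∎)
  where open ≡-Reasoning

closed-form-step : ∀ b U x → b * U ≡ U + x - 1ℚ →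
  (b + ℕ→ℚ 8) * (+ 1 / 9) * (ℕ→ℚ 9 * U) ≡ ℕ→ℚ 9 * U + x - 1ℚ
closed-form-step b U x bU≡U+x-1 = begin
  (b + ℕ→ℚ 8) * (+ 1 / 9) * (ℕ→ℚ 9 * U) ≡⟨ solve (b ∷ U ∷ []) ℚ-ring ⟩
  b * U + ℕ→ℚ 8 * U                      ≡⟨ cong (_+ ℕ→ℚ 8 * U) bU≡U+x-1 ⟩
  U + x - 1ℚ + ℕ→ℚ 8 * U                 ≡⟨ solve (U ∷ x ∷ []) ℚ-ring ⟩
  ℕ→ℚ 9 * U + x - 1ℚ                     ∎
  where open ≡-Reasoning

module _ (X : ℕ → ℚ) (X>0 : ∀ i → 0ℚ < X i) where

  stripLabel-pos : ∀ k → 0ℚ < stripLabel X k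
  stripLabel-suc : ∀ k → stripLabel X (suc k) ≡ (stripLabel X k + ℕ→ℚ 8) * (+ 1 / 9)

  stripLabel-pos zero    = X>0 1
  stripLabel-pos (suc k) rewrite stripLabel-suc k =
    ℚ.*-monoˡ-<-pos (+ 1 / 9) (ℚ.+-mono-< (stripLabel-pos k) (ℚ.positive⁻¹ (ℕ→ℚ 8)))

  stripLabel-suc k =
    Yf-third-third (Δ 1ℚ 1ℚ (stripLabel X k)) (stripLabel X k) (Δ-one-one (stripLabel X k) (stripLabel-pos k))

  stripLabel-closed : ∀ k → stripLabel X k * ℕ→ℚ (9 ^ k) ≡ ℕ→ℚ (9 ^ k) + X 1 - 1ℚ
  stripLabel-closed zero    = x*1≡1+x-1 (X 1)
    where
    x*1≡1+x-1 : ∀ x → x * 1ℚ ≡ 1ℚ + x - 1ℚ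
    x*1≡1+x-1 x = solve (x ∷ []) ℚ-ring
  stripLabel-closed (suc k) = begin
    stripLabel X (suc k) * ℕ→ℚ (9 ^ suc k)
      ≡⟨ cong₂ _*_ (stripLabel-suc k) (ℕ→ℚ-homo-* 9 (9 ^ k)) ⟩
    (stripLabel X k + ℕ→ℚ 8) * (+ 1 / 9) * (ℕ→ℚ 9 * ℕ→ℚ (9 ^ k))
      ≡⟨ closed-form-step (stripLabel X k) (ℕ→ℚ (9 ^ k)) (X 1) (stripLabel-closed k) ⟩
    ℕ→ℚ 9 * ℕ→ℚ (9 ^ k) + X 1 - 1ℚ
      ≡⟨ cong (λ u → u + X 1 - 1ℚ) (ℕ→ℚ-homo-* 9 (9 ^ k)) ⟨
    ℕ→ℚ (9 ^ suc k) + X 1 - 1ℚ ∎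
    where open ≡-Reasoning

-- With t = 1/(2 + b) and bU = U + x - 1 we get t (x + 3U - 1) = U, which
-- both shows that the denominator is nonzero and evaluates third + 2t.
Yf-third-third-closed : ∀ t b U x → t * (1ℚ + 1ℚ + b) ≡ 1ℚ → b * U ≡ U + x - 1ℚ → U ≢ 0ℚ →
  Yf third third t ≡ (ℕ→ℚ 9 * U - 1ℚ + x) ⊘ (ℕ→ℚ 3 * (x + ℕ→ℚ 3 * U - 1ℚ))
Yf-third-third-closed t b U x t[2+b]≡1 bU≡U+x-1 U≢0 =
  trans (⊘-unique (third + t + t) (λ ()) numerator) (sym (⊘-unique (third + t + t) D≢0 N≡VD))
  where
  open ≡-Reasoning
  numerator : third * third + third * t + t * third ≡ (third + t + t) * third
  numerator = solve (t ∷ []) ℚ-ring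
  t[x+3U-1]≡U : t * (x + ℕ→ℚ 3 * U - 1ℚ) ≡ U
  t[x+3U-1]≡U = begin
    t * (x + ℕ→ℚ 3 * U - 1ℚ)  ≡⟨ solve (t ∷ U ∷ x ∷ []) ℚ-ring ⟩
    t * (U + x - 1ℚ + U + U)  ≡⟨ cong (λ v → t * (v + U + U)) bU≡U+x-1 ⟨
    t * (b * U + U + U)       ≡⟨ solve (t ∷ b ∷ U ∷ []) ℚ-ring ⟩
    U * (t * (1ℚ + 1ℚ + b))   ≡⟨ cong (U *_) t[2+b]≡1 ⟩
    U * 1ℚ                    ≡⟨ ℚ.*-identityʳ U ⟩
    U                         ∎
  D[t/3]≡U : ℕ→ℚ 3 * (x + ℕ→ℚ 3 * U - 1ℚ) * (third * t) ≡ U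
  D[t/3]≡U = begin
    ℕ→ℚ 3 * (x + ℕ→ℚ 3 * U - 1ℚ) * (third * t) ≡⟨ solve (t ∷ U ∷ x ∷ []) ℚ-ring ⟩
    t * (x + ℕ→ℚ 3 * U - 1ℚ)                   ≡⟨ t[x+3U-1]≡U ⟩
    U                                          ∎
  D≢0 : ℕ→ℚ 3 * (x + ℕ→ℚ 3 * U - 1ℚ) ≢ 0ℚ
  D≢0 = *≡≢0⇒≢0ˡ D[t/3]≡U U≢0
  N≡VD : ℕ→ℚ 9 * U - 1ℚ + x ≡ (third + t + t) * (ℕ→ℚ 3 * (x + ℕ→ℚ 3 * U - 1ℚ))
  N≡VD = begin
    ℕ→ℚ 9 * U - 1ℚ + x
      ≡⟨ solve (U ∷ x ∷ []) ℚ-ring ⟩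
    x + ℕ→ℚ 3 * U - 1ℚ + ℕ→ℚ 6 * U
      ≡⟨ cong (λ v → x + ℕ→ℚ 3 * U - 1ℚ + ℕ→ℚ 6 * v) t[x+3U-1]≡U ⟨
    x + ℕ→ℚ 3 * U - 1ℚ + ℕ→ℚ 6 * (t * (x + ℕ→ℚ 3 * U - 1ℚ))
      ≡⟨ solve (t ∷ U ∷ x ∷ []) ℚ-ring ⟩
    (third + t + t) * (ℕ→ℚ 3 * (x + ℕ→ℚ 3 * U - 1ℚ)) ∎

corollary4p10 : (s : ℕ) → 2 ≤ s → (n : ℕ) → 4 ℕ.* s ∸ 2 ≤ n →
    (X : ℕ → ℚ) → (∀ i → 0ℚ < X i) →
    CM X n 1 s ≡
      ((ℕ→ℚ (9 ^ (s ∸ 1)) - 1ℚ) + X 1)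
        ⊘ (ℕ→ℚ 3 * (X 1 + ℕ→ℚ 3 * ℕ→ℚ (9 ^ (s ∸ 2)) - 1ℚ))
corollary4p10 (suc zero) (s≤s ()) _ _ _ _
corollary4p10 (suc (suc k)) _ n 4s-2≤n X X>0 = begin
  CM X n 1 (suc (suc k))
    ≡⟨ CM-1-strip X n k 4s-2≤n ⟩
  Yf third third (Δ 1ℚ 1ℚ b)
    ≡⟨ Yf-third-third-closed (Δ 1ℚ 1ℚ b) b U (X 1) (Δ-one-one b (stripLabel-pos X X>0 k))
         (stripLabel-closed X X>0 k) (ℕ→ℚ-≢0 (9 ^ k) {{ℕ.m^n≢0 9 k}}) ⟩
  (ℕ→ℚ 9 * U - 1ℚ + X 1) ⊘ D
    ≡⟨ cong (λ v → (v - 1ℚ + X 1) ⊘ D) (ℕ→ℚ-homo-* 9 (9 ^ k)) ⟨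
  (ℕ→ℚ (9 ^ suc k) - 1ℚ + X 1) ⊘ D ∎
  where
  open ≡-Reasoning
  b U D : ℚ
  b = stripLabel X k
  U = ℕ→ℚ (9 ^ k)
  D = ℕ→ℚ 3 * (X 1 + ℕ→ℚ 3 * U - 1ℚ)
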